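{- Let $T$ be an orientation (tournament) of the complete graph $K_8$. If there exists a vertex $v \in V(T)$ such that $id(v)=1$ or $od(v)=1$, then $\gamma^{*}(T) \leq 4$.
   Context: For a digraph $D=(V,A)$ and $v \in V$, $I(v)=\{u : (u,v)\in A\}$, $O(v)=\{u : (v,u)\in A\}$, $id(v)=|I(v)|$ and $od(v)=|O(v)|$. A subset $S \subseteq V$ is a twin dominating set of $D$ if for every vertex $v \in V - S$ there exist vertices $u_1, u_2 \in S$ (possibly equal) such that $(v,u_1)$ and $(u_2,v)$ are arcs of $D$. The twin domination number $\gamma^{*}(D)$ is the minimum cardinality of a twin dominating set of $D$. -}

module Defs where

open import Data.Nat using (ℕ; _≤_)
open import Data.Bool using (Bool; true; false)
open import Data.Fin using (Fin)
open import Data.Fin.Subset using (Subset; _∈_; _∉_; ∣_∣)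
open import Data.Vec using (tabulate)
open import Data.Product using (Σ; _×_; ∃-syntax)
open import Relation.Binary.PropositionalEquality using (_≡_; _≢_)
open import Relation.Nullary using (¬_)

Digraph : ℕ → Set
Digraph n = Fin n → Fin n → Bool

Arc : ∀ {n} → Digraph n → Fin n → Fin n → Set
Arc A u v = A u v ≡ true

IsTournament : ∀ {n} → Digraph n → Set
IsTournament {n} A =
  (∀ (v : Fin n) → ¬ Arc A v v) ×
  (∀ (u v : Fin n) → u ≢ v → (Arc A u v → ¬ Arc A v u) × (¬ Arc A u v → Arc A v u))

I : ∀ {n} → Digraph n → Fin n → Subset n
I A v = tabulate (λ u → A u v)

O : ∀ {n} → Digraph n → Fin n → Subset n
O A v = tabulate (λ u → A v u)

id : ∀ {n} → Digraph n → Fin n → ℕ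
id A v = ∣ I A v ∣

od : ∀ {n} → Digraph n → Fin n → ℕ
od A v = ∣ O A v ∣

IsTwinDominating : ∀ {n} → Digraph n → Subset n → Set
IsTwinDominating {n} A S =
  ∀ (v : Fin n) → v ∉ S →
    (∃[ u₁ ] (u₁ ∈ S × Arc A v u₁)) × (∃[ u₂ ] (u₂ ∈ S × Arc A u₂ v))

-- γ*(D) ≤ k : some twin dominating set has cardinality ≤ k
-- (equivalent to the minimum cardinality being ≤ k).
TwinDomNumberAtMost : ∀ {n} → Digraph n → ℕ → Set
TwinDomNumberAtMost {n} A k = ∃[ S ] (IsTwinDominating A S × ∣ S ∣ ≤ k)

module Submission where

-- Let v be a vertex of the 8-tournament T with id(v) = 1, and
-- let w be its unique in-neighbour; then v → x for every x ∉ {v, w}.  The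
-- six remaining vertices induce a tournament R, and it suffices to find a
-- pair {a, b} in R absorbing R (every other vertex of R has an arc into a
-- or b): then {v, w, a, b} is twin dominating, v giving in-arcs and {a, b}
-- out-arcs.  Such a pair exists by double counting: the out-degrees of an
-- n-tournament sum to n(n-1)/2, so some vertex a of R has out-degree ≤ 2;
-- every vertex other than a and its ≤ 2 out-neighbours beats a, and among
-- those out-neighbours one (b) is beaten by the other.  The case od(v) = 1
-- reduces to the first by reversing all arcs, which preserves tournaments
-- and twin domination.

open import Defs
open import Data.Nat using (ℕ; zero; suc; pred; _+_; _*_; _≤_; _<_; s≤s)
open import Data.Nat.Properties
  using (+-suc; +-assoc; +-mono-≤; ≤-trans; ≤-reflexive; ≤-refl; m≤n⇒m≤1+n; <⇒≱; ≰⇒>; _≤?_; _<?_; +-0-commutativeMonoid)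
open import Data.Bool using (Bool; true; false; not)
open import Data.Bool.Properties using (¬-not)
open import Data.Fin using (Fin; zero; suc; _≟_; punchIn; punchOut)
open import Data.Fin.Properties using (any?; suc-injective; punchIn-injective; punchIn-punchOut; punchInᵢ≢i)
open import Data.Fin.Subset using (Subset; _∈_; _∉_; ∣_∣; ⁅_⁆; _∪_)
open import Data.Fin.Subset.Properties using (x∈⁅x⁆; x∈p∪q⁺; ∣⁅x⁆∣≡1)
open import Data.Vec using ([]; _∷_; tabulate; here; there)
open import Data.Vec.Properties using (lookup∘tabulate; []=⇒lookup; lookup⇒[]=)
open import Data.List using (List; []; _∷_; length; map)
open import Data.List.Properties using (length-map)
open import Data.List.Membership.Propositional using () renaming (_∈_ to _∈ₗ_)
open import Data.List.Membership.Propositional.Properties using (∈-map⁺)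
import Data.List.Relation.Unary.Any as Any
open import Data.Sum using (_⊎_; inj₁; inj₂)
open import Data.Product using (_×_; _,_; proj₁; proj₂; ∃-syntax)
open import Data.Empty using (⊥-elim)
open import Function using (_∘_)
open import Relation.Nullary using (yes; no; ¬_; contradiction)
open import Relation.Nullary.Decidable using (toWitness)
open import Relation.Binary.PropositionalEquality
  using (_≡_; _≢_; refl; sym; trans; cong; cong₂; subst; module ≡-Reasoning)
open import Algebra.Properties.CommutativeMonoid.Sum +-0-commutativeMonoid
  using (sum; ∑-distrib-+; sum-cong-≗)

indicator : Bool → ℕ
indicator true  = 1
indicator false = 0

count : ∀ {n} → (Fin n → Bool) → ℕ
count p = sum (indicator ∘ p)

count-complement : ∀ {n} (p : Fin n → Bool) → count p + count (not ∘ p) ≡ n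
count-complement {zero}  p = refl
count-complement {suc n} p with p zero
... | true  = cong suc (count-complement (p ∘ suc))
... | false = trans (+-suc _ _) (cong suc (count-complement (p ∘ suc)))

sum-lower-bound : ∀ {n} (f : Fin n → ℕ) {c} → (∀ x → c ≤ f x) → n * c ≤ sum f
sum-lower-bound {zero}  f below = ≤-refl
sum-lower-bound {suc n} f below =
  +-mono-≤ (below zero) (sum-lower-bound (f ∘ suc) (below ∘ suc))

support : ∀ {n} (p : Fin n → Bool) →
  ∃[ xs ] (length xs ≡ count p × (∀ x → p x ≡ true → x ∈ₗ xs))
support {zero}  p = [] , refl , λ ()
support {suc n} p with support (p ∘ suc)
... | xs , len , complete with p zero in p0
...   | true  = zero ∷ map suc xs , cong suc (trans (length-map suc xs) len) , member
  where
  member : ∀ x → p x ≡ true → x ∈ₗ zero ∷ map suc xs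
  member zero    _  = Any.here refl
  member (suc x) px = Any.there (∈-map⁺ suc (complete x px))
...   | false = map suc xs , trans (length-map suc xs) len , member
  where
  member : ∀ x → p x ≡ true → x ∈ₗ map suc xs
  member zero    px = contradiction (trans (sym p0) px) λ ()
  member (suc x) px = ∈-map⁺ suc (complete x px)

module _ {n} {g : Digraph n} (tour : IsTournament g) where

  loopless : ∀ x → g x x ≡ false
  loopless x = ¬-not (proj₁ tour x)

  converse : ∀ {x y} → x ≢ y → g y x ≡ not (g x y)
  converse {x} {y} x≢y with g x y in xy
  ... | true  = ¬-not (proj₁ (proj₂ tour x y x≢y) xy)
  ... | false = proj₂ (proj₂ tour x y x≢y) (λ arc → contradiction (trans (sym xy) arc) λ ())

  beaten-or-equal : ∀ x y → g x y ≡ false → y ≡ x ⊎ Arc g y x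
  beaten-or-equal x y xy with y ≟ x
  ... | yes y≡x = inj₁ y≡x
  ... | no  y≢x = inj₂ (proj₂ (proj₂ tour x y (y≢x ∘ sym))
                          (λ arc → contradiction (trans (sym xy) arc) λ ()))

induced : ∀ {m n} {T : Digraph n} (e : Fin m → Fin n) →
  (∀ {i j} → e i ≡ e j → i ≡ j) → IsTournament T →
  IsTournament (λ i j → T (e i) (e j))
induced e e-injective (no-loops , orient) =
  (λ i → no-loops (e i)) , λ i j i≢j → orient (e i) (e j) (i≢j ∘ e-injective)

transpose : ∀ {n} → Digraph n → Digraph n
transpose T u v = T v u

transpose-tournament : ∀ {n} {T : Digraph n} → IsTournament T → IsTournament (transpose T)
transpose-tournament (no-loops , orient) =
  no-loops , λ u v u≢v → orient v u (u≢v ∘ sym)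

-- tri n = n(n-1)/2, the number of pairs of vertices.
tri : ℕ → ℕ
tri zero    = 0
tri (suc n) = n + tri n

-- Every pair of vertices contributes exactly one arc.
outdegree-sum : ∀ {n} {g : Digraph n} → IsTournament g → sum (λ x → count (g x)) ≡ tri n
outdegree-sum {zero}      tour = refl
outdegree-sum {suc n} {g} tour = begin
  count (g zero) + sum (λ x → count (g (suc x)))
    ≡⟨ cong (λ b → indicator b + count out + sum (λ x → count (g (suc x)))) (loopless tour zero) ⟩
  count out + sum (λ x → indicator (g (suc x) zero) + count (rest x))
    ≡⟨ cong (count out +_) (∑-distrib-+ (λ x → indicator (into x)) (λ x → count (rest x))) ⟩
  count out + (count into + sum (λ x → count (rest x)))
    ≡⟨ sym (+-assoc (count out) _ _) ⟩
  count out + count into + sum (λ x → count (rest x))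
    ≡⟨ cong₂ _+_ out-plus-in (outdegree-sum (induced suc suc-injective tour)) ⟩
  n + tri n ∎
  where
  open ≡-Reasoning
  out into : Fin n → Bool
  out  x = g zero (suc x)
  into x = g (suc x) zero
  rest : Digraph n
  rest i j = g (suc i) (suc j)
  out-plus-in : count out + count into ≡ n
  out-plus-in = trans (cong (count out +_)
                             (sum-cong-≗ (λ x → cong indicator (converse tour {zero} {suc x} (λ ())))))
                      (count-complement out)

low-outdegree : ∀ {n} {g : Digraph n} → IsTournament g →
  ∀ k → tri n < n * suc k → ∃[ x ] count (g x) ≤ k
low-outdegree {n} {g} tour k few-arcs with any? (λ x → count (g x) ≤? k)
... | yes found = found
... | no  none  = contradiction (sum-lower-bound (λ x → count (g x)) all-high)
                    (subst (λ s → ¬ n * suc k ≤ s) (sym (outdegree-sum tour)) (<⇒≱ few-arcs))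
  where
  all-high : ∀ x → suc k ≤ count (g x)
  all-high x = ≰⇒> (λ low → none (x , low))

AbsorbingPair : ∀ {n} → Digraph n → Fin n → Fin n → Set
AbsorbingPair g a b = ∀ x → x ≡ a ⊎ x ≡ b ⊎ Arc g x a ⊎ Arc g x b

-- Among at most two vertices one, b, is beaten by the others
-- (d is a default answer for the empty list).
local-sink : ∀ {n} {g : Digraph n} → IsTournament g → Fin n →
  (xs : List (Fin n)) → length xs ≤ 2 → ∃[ b ] (∀ {x} → x ∈ₗ xs → x ≡ b ⊎ Arc g x b)
local-sink tour d [] _ = d , λ ()
local-sink tour d (y ∷ []) _ = y , λ { (Any.here x≡y) → inj₁ x≡y }
local-sink {g = g} tour d (y ∷ z ∷ []) _ with g y z in yz
... | true  = z , λ { (Any.here refl) → inj₂ yz ; (Any.there (Any.here x≡z)) → inj₁ x≡z }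
... | false = y , λ { (Any.here x≡y) → inj₁ x≡y ; (Any.there (Any.here refl)) → beaten-or-equal tour y z yz }
local-sink tour d (_ ∷ _ ∷ _ ∷ _) (s≤s (s≤s ()))

-- A vertex of out-degree ≤ 2 lies in an absorbing pair: vertices not beaten
-- by a beat a, and a's out-neighbours are handled by their local sink.
absorbing-pair : ∀ {n} {g : Digraph n} → IsTournament g →
  ∀ a → count (g a) ≤ 2 → ∃[ b ] AbsorbingPair g a b
absorbing-pair {g = g} tour a low with support (g a)
... | xs , len , complete with local-sink tour a xs (subst (_≤ 2) (sym len) low)
... | b , sink = b , absorb
  where
  absorb : AbsorbingPair g a b
  absorb x with g a x in ax
  ... | true with sink (complete x ax)
  ...   | inj₁ x≡b = inj₂ (inj₁ x≡b)
  ...   | inj₂ xb  = inj₂ (inj₂ (inj₂ xb))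
  absorb x | false with beaten-or-equal tour a x ax
  ...   | inj₁ x≡a = inj₁ x≡a
  ...   | inj₂ xa  = inj₂ (inj₂ (inj₁ xa))

-- Tournaments of order n with n(n-1)/2 < 3n (i.e. 1 ≤ n ≤ 6) have an
-- absorbing pair.
small-absorbing-pair : ∀ {n} {g : Digraph n} → IsTournament g →
  tri n < n * 3 → ∃[ a ] ∃[ b ] AbsorbingPair g a b
small-absorbing-pair tour small with low-outdegree tour 2 small
... | a , low = a , absorbing-pair tour a low

∣p∪q∣≤∣p∣+∣q∣ : ∀ {n} (p q : Subset n) → ∣ p ∪ q ∣ ≤ ∣ p ∣ + ∣ q ∣
∣p∪q∣≤∣p∣+∣q∣ []          []          = ≤-refl
∣p∪q∣≤∣p∣+∣q∣ (true ∷ p)  (true ∷ q)  =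
  s≤s (≤-trans (m≤n⇒m≤1+n (∣p∪q∣≤∣p∣+∣q∣ p q)) (≤-reflexive (sym (+-suc _ _))))
∣p∪q∣≤∣p∣+∣q∣ (true ∷ p)  (false ∷ q) = s≤s (∣p∪q∣≤∣p∣+∣q∣ p q)
∣p∪q∣≤∣p∣+∣q∣ (false ∷ p) (true ∷ q)  =
  ≤-trans (s≤s (∣p∪q∣≤∣p∣+∣q∣ p q)) (≤-reflexive (sym (+-suc _ _)))
∣p∪q∣≤∣p∣+∣q∣ (false ∷ p) (false ∷ q) = ∣p∪q∣≤∣p∣+∣q∣ p q

∣p∣≡0⇒empty : ∀ {n} (p : Subset n) → ∣ p ∣ ≡ 0 → ∀ u → u ∉ p
∣p∣≡0⇒empty (false ∷ p) size (suc u) (there u∈p) = ∣p∣≡0⇒empty p size u u∈p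

∣p∣≡1⇒singleton : ∀ {n} (p : Subset n) → ∣ p ∣ ≡ 1 → ∃[ w ] (w ∈ p × (∀ u → u ∈ p → u ≡ w))
∣p∣≡1⇒singleton (true ∷ p) size =
  zero , here , λ { zero _ → refl
                  ; (suc u) (there u∈p) → ⊥-elim (∣p∣≡0⇒empty p (cong pred size) u u∈p) }
∣p∣≡1⇒singleton (false ∷ p) size with ∣p∣≡1⇒singleton p size
... | w , w∈p , unique = suc w , there w∈p , λ { (suc u) (there u∈p) → cong suc (unique u u∈p) }

unique-in-neighbour : ∀ {n} (T : Digraph n) v → id T v ≡ 1 →
  ∃[ w ] (Arc T w v × (∀ u → Arc T u v → u ≡ w))
unique-in-neighbour T v size with ∣p∣≡1⇒singleton (I T v) size
... | w , w∈I , unique =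
  w , trans (sym (lookup∘tabulate (λ u → T u v) w)) ([]=⇒lookup w∈I) ,
  λ u arc → unique u (lookup⇒[]= u (I T v) (trans (lookup∘tabulate (λ u → T u v) u) arc))

-- The vertices of Fin (2 + n) other than two distinct v and w, enumerated
-- injectively by Fin n.
module _ {n} {v w : Fin (suc (suc n))} (v≢w : v ≢ w) where

  skip : Fin n → Fin (suc (suc n))
  skip i = punchIn v (punchIn (punchOut v≢w) i)

  skip-injective : ∀ {i j} → skip i ≡ skip j → i ≡ j
  skip-injective {i} {j} eq = punchIn-injective _ i j (punchIn-injective v _ _ eq)

  skip-onto : ∀ x → x ≢ v → x ≢ w → ∃[ i ] skip i ≡ x
  skip-onto x x≢v x≢w = punchOut w′≢j , trans (cong (punchIn v) (punchIn-punchOut w′≢j)) jx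
    where
    j = punchOut (x≢v ∘ sym)
    jx : punchIn v j ≡ x
    jx = punchIn-punchOut (x≢v ∘ sym)
    w′≢j : punchOut v≢w ≢ j
    w′≢j eq = x≢w (trans (sym jx) (trans (cong (punchIn v) (sym eq)) (punchIn-punchOut v≢w)))

  skip-avoids₁ : ∀ i → skip i ≢ v
  skip-avoids₁ i = punchInᵢ≢i v _

  skip-avoids₂ : ∀ i → skip i ≢ w
  skip-avoids₂ i eq = punchInᵢ≢i (punchOut v≢w) i
    (punchIn-injective v _ _ (trans eq (sym (punchIn-punchOut v≢w))))

quad : ∀ {n} → Fin n → Fin n → Fin n → Fin n → Subset n
quad v w a b = ⁅ v ⁆ ∪ (⁅ w ⁆ ∪ (⁅ a ⁆ ∪ ⁅ b ⁆))

module _ {n} (v w a b : Fin n) where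

  ∣quad∣≤4 : ∣ quad v w a b ∣ ≤ 4
  ∣quad∣≤4 =
    ≤-trans (∣p∪q∣≤∣p∣+∣q∣ ⁅ v ⁆ _) (+-mono-≤ (≤-reflexive (∣⁅x⁆∣≡1 v))
      (≤-trans (∣p∪q∣≤∣p∣+∣q∣ ⁅ w ⁆ _) (+-mono-≤ (≤-reflexive (∣⁅x⁆∣≡1 w))
        (≤-trans (∣p∪q∣≤∣p∣+∣q∣ ⁅ a ⁆ _)
          (+-mono-≤ (≤-reflexive (∣⁅x⁆∣≡1 a)) (≤-reflexive (∣⁅x⁆∣≡1 b)))))))

  v∈quad : v ∈ quad v w a b
  v∈quad = x∈p∪q⁺ (inj₁ (x∈⁅x⁆ v))

  w∈quad : w ∈ quad v w a b
  w∈quad = x∈p∪q⁺ (inj₂ (x∈p∪q⁺ (inj₁ (x∈⁅x⁆ w))))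

  a∈quad : a ∈ quad v w a b
  a∈quad = x∈p∪q⁺ (inj₂ (x∈p∪q⁺ (inj₂ (x∈p∪q⁺ (inj₁ (x∈⁅x⁆ a))))))

  b∈quad : b ∈ quad v w a b
  b∈quad = x∈p∪q⁺ (inj₂ (x∈p∪q⁺ (inj₂ (x∈p∪q⁺ (inj₂ (x∈⁅x⁆ b))))))

quad-twin-dominating : ∀ {n} (T : Digraph n) (v w a b : Fin n) →
  (∀ x → x ∉ quad v w a b → Arc T v x × (Arc T x a ⊎ Arc T x b)) →
  TwinDomNumberAtMost T 4
quad-twin-dominating T v w a b covered = quad v w a b , twin , ∣quad∣≤4 v w a b
  where
  twin : IsTwinDominating T (quad v w a b)
  twin x x∉S with covered x x∉S
  ... | vx , inj₁ xa = (a , a∈quad v w a b , xa) , (v , v∈quad v w a b , vx)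
  ... | vx , inj₂ xb = (b , b∈quad v w a b , xb) , (v , v∈quad v w a b , vx)

dominator-plus-absorbing-pair : ∀ {n} {T : Digraph (suc (suc n))} {v w} (v≢w : v ≢ w) →
  (∀ x → x ≢ v → x ≢ w → Arc T v x) →
  ∀ {a b} → AbsorbingPair (λ i j → T (skip v≢w i) (skip v≢w j)) a b →
  TwinDomNumberAtMost T 4
dominator-plus-absorbing-pair {T = T} {v} {w} v≢w v-beats {a} {b} absorbs =
  quad-twin-dominating T v w (skip v≢w a) (skip v≢w b) covered
  where
  covered : ∀ x → x ∉ quad v w (skip v≢w a) (skip v≢w b) →
    Arc T v x × (Arc T x (skip v≢w a) ⊎ Arc T x (skip v≢w b))
  covered x x∉S with skip-onto v≢w x x≢v x≢w
    where
    x≢v : x ≢ v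
    x≢v refl = x∉S (v∈quad x w _ _)
    x≢w : x ≢ w
    x≢w refl = x∉S (w∈quad v x _ _)
  ... | i , refl with absorbs i
  ...   | inj₁ refl        = ⊥-elim (x∉S (a∈quad v w _ _))
  ...   | inj₂ (inj₁ refl) = ⊥-elim (x∉S (b∈quad v w _ _))
  ...   | inj₂ (inj₂ into-a-or-b) =
    v-beats _ (skip-avoids₁ v≢w i) (skip-avoids₂ v≢w i) , into-a-or-b

in-degree-one-bound : ∀ {n} (T : Digraph (suc (suc n))) → IsTournament T →
  tri n < n * 3 → ∀ v → id T v ≡ 1 → TwinDomNumberAtMost T 4
in-degree-one-bound T tour small v in-one with unique-in-neighbour T v in-one
... | w , wv , only-w with small-absorbing-pair (induced (skip v≢w) (skip-injective v≢w) tour) small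
  where
  v≢w : v ≢ w
  v≢w v≡w = proj₁ tour v (subst (λ u → Arc T u v) (sym v≡w) wv)
... | a , b , absorbs = dominator-plus-absorbing-pair _ v-beats absorbs
  where
  v-beats : ∀ x → x ≢ v → x ≢ w → Arc T v x
  v-beats x x≢v x≢w = proj₂ (proj₂ tour x v x≢v) (x≢w ∘ only-w x)

transpose-twin-dominating : ∀ {n} {T : Digraph n} {k} →
  TwinDomNumberAtMost (transpose T) k → TwinDomNumberAtMost T k
transpose-twin-dominating (S , twin , size) =
  S , (λ x x∉S → proj₂ (twin x x∉S) , proj₁ (twin x x∉S)) , size

-- Order 8 = 6 + 2 is within the range of the main lemma.
six-is-small : tri 6 < 6 * 3
six-is-small = toWitness {a? = tri 6 <? 6 * 3} _

-- In the transposed tournament the in-degree of v is its original out-degree.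
theorem2p3 : (T : Digraph 8) → IsTournament T →
    (∃[ v ] (id T v ≡ 1 ⊎ od T v ≡ 1)) →
    TwinDomNumberAtMost T 4
theorem2p3 T tour (v , inj₁ in-one) = in-degree-one-bound T tour six-is-small v in-one
theorem2p3 T tour (v , inj₂ out-one) =
  transpose-twin-dominating
    (in-degree-one-bound (transpose T) (transpose-tournament tour) six-is-small v out-one)
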